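{- Let $G$ be a connected finite simple graph. Then $\lambda(\mathcal{D}[G])=4\lambda(G)$ if $\lambda(G)\le\frac{\delta(G)}{2}$, and $\lambda(\mathcal{D}[G])=2\delta(G)$ if $\frac{\delta(G)}{2}<\lambda(G)<\delta(G)$. Here $\lambda$ denotes edge-connectivity and $\delta$ minimum degree.
   Context: The total graph $T_2$ is $K_2$ with a loop added at each of its two vertices. The double graph is $\mathcal{D}[G]=G\times T_2$ (Kronecker product): it has vertex set $V(G)\times\{0,1\}$ and $(u,i)$ is adjacent to $(v,j)$ iff $uv\in E(G)$. -}

module Defs where

open import Data.Nat using (ℕ; zero; suc; _+_; _*_; _∸_; _≤_; _<_; _⊓_; _<ᵇ_)
open import Data.Bool using (Bool; true; false; _∧_; if_then_else_)
open import Data.Fin using (Fin; toℕ; splitAt)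
open import Data.Sum using (_⊎_; [_,_]′)
open import Data.Product using (Σ; _×_; _,_; ∃)
open import Relation.Binary.PropositionalEquality using (_≡_)
open import Relation.Nullary using (¬_)
open import Function using (id)

record Graph (n : ℕ) : Set where
  field
    adj    : Fin n → Fin n → Bool
    sym    : ∀ u v → adj u v ≡ adj v u
    irrefl : ∀ u → adj u u ≡ false
open Graph public

countFin : ∀ {n} → (Fin n → Bool) → ℕ
countFin {zero}  p = 0
countFin {suc n} p = (if p Fin.zero then 1 else 0) + countFin (λ i → p (Fin.suc i))

sumFin : ∀ {n} → (Fin n → ℕ) → ℕ
sumFin {zero}  f = 0
sumFin {suc n} f = f Fin.zero + sumFin (λ i → f (Fin.suc i))

deg : ∀ {n} → Graph n → Fin n → ℕ
deg G v = countFin (adj G v)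

minFin : ∀ {m} → (Fin (suc m) → ℕ) → ℕ
minFin {zero}  f = f Fin.zero
minFin {suc m} f = f Fin.zero ⊓ minFin (λ i → f (Fin.suc i))

δ : ∀ {m} → Graph (suc m) → ℕ
δ G = minFin (deg G)

edgeCount : ∀ {n} → Graph n → ℕ
edgeCount G = sumFin (λ i → countFin (λ j → adj G i j ∧ (toℕ i <ᵇ toℕ j)))

data Reach {n : ℕ} (G : Graph n) : Fin n → Fin n → Set where
  here : ∀ {u} → Reach G u u
  step : ∀ {u v w} → adj G u v ≡ true → Reach G v w → Reach G u w

Connected : ∀ {n} → Graph n → Set
Connected G = ∀ u v → Reach G u v

-- H is a spanning subgraph of G (H = G - F with F = E(G) \ E(H))
SpanningSub : ∀ {n} → Graph n → Graph n → Set
SpanningSub H G = ∀ u v → adj H u v ≡ true → adj G u v ≡ true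

-- k = λ(G), the edge-connectivity: the minimum number of edges whose
-- removal disconnects G (convention: λ = 0 for the one-vertex graph,
-- where no edge set disconnects).
IsEdgeConnectivity : ∀ {n} → Graph n → ℕ → Set
IsEdgeConnectivity {n} G k =
  ((Σ (Graph n) λ H → SpanningSub H G × ¬ Connected H
       × (edgeCount G ∸ edgeCount H ≡ k))
    ⊎ (n ≤ 1 × k ≡ 0))
  × (∀ H → SpanningSub H G → ¬ Connected H → k ≤ edgeCount G ∸ edgeCount H)

-- projection V(G) × {0,1} → V(G), with V × {0,1} encoded as Fin (n + n)
proj : ∀ {n} → Fin (n + n) → Fin n
proj {n} x = [ id , id ]′ (splitAt n x)

-- the double graph D[G] = G × T₂ : (u,i) ~ (v,j) iff uv ∈ E(G)
double : ∀ {n} → Graph n → Graph (n + n)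
double G = record
  { adj    = λ x y → adj G (proj x) (proj y)
  ; sym    = λ x y → sym G (proj x) (proj y)
  ; irrefl = λ x → irrefl G (proj x)
  }

module Submission where

-- A disconnecting edge set of D[G] contains every edge between some vertex set S
-- and its complement, where S is a union of components of what remains. If S
-- contains both copies (u,0), (u,1) of each vertex u or neither, these edges are
-- four copies of the edges leaving a nonempty proper vertex set of G, so there are
-- at least 4λ(G) of them. Otherwise exactly one copy of some vertex w lies in S, and
-- for every neighbour v of w exactly two of the four edges between the copies of w
-- and of v leave S, giving at least 2 deg(w) ≥ 2δ(G) edges. Both values are
-- attained: double a minimum disconnecting set of G, or isolate one copy of a vertex
-- of minimum degree. Hence λ(D[G]) = min(4λ(G), 2δ(G)).

open import Defs hiding (sym)
open Graph using () renaming (sym to adj-sym)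
open import Data.Nat using (ℕ; zero; suc; _+_; _*_; _∸_; _≤_; _<_; _⊓_; _<ᵇ_; _≤?_; z≤n; s≤s)
open import Data.Nat.Properties hiding (_≟_)
open import Data.Nat.Solver using (module +-*-Solver)
open import Data.Bool using (Bool; true; false; _∧_; not; _xor_)
open import Data.Bool.Properties using (xor-comm) renaming (_≟_ to _≟ᵇ_)
open import Data.Fin using (Fin; toℕ; splitAt; _↑ˡ_; _↑ʳ_; punchIn; _≟_)
open import Data.Fin.Properties
  using ( splitAt-↑ˡ; splitAt-↑ʳ; splitAt⁻¹-↑ˡ; splitAt⁻¹-↑ʳ; toℕ-injective; punchInᵢ≢i
        ; all?; ¬∀⟶∃¬)
open import Data.Sum using (_⊎_; inj₁; inj₂; [_,_]′)
open import Data.Product using (Σ; _×_; _,_; ∃; proj₁; proj₂)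
open import Data.Empty using (⊥-elim)
open import Function using (_∘_; id; case_of_)
open import Relation.Binary.PropositionalEquality
open import Relation.Nullary using (¬_; Dec; yes; no; does)
open import Relation.Nullary.Negation using (¬¬-map)
open import Relation.Nullary.Decidable using (dec-true; dec-false; decidable-stable; ¬¬-excluded-middle)
open import Algebra.Properties.Semiring.Sum +-*-semiring
open +-*-Solver using (solve; _:+_; _:*_; _:=_; con)

⟦_⟧ : Bool → ℕ
⟦ true ⟧ = 1
⟦ false ⟧ = 0

sumFin≡sum : ∀ {n} (f : Fin n → ℕ) → sumFin f ≡ sum f
sumFin≡sum {zero} f = refl
sumFin≡sum {suc n} f = cong (f Fin.zero +_) (sumFin≡sum (f ∘ Fin.suc))

countFin≡sum : ∀ {n} (p : Fin n → Bool) → countFin p ≡ ∑[ i < n ] ⟦ p i ⟧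
countFin≡sum {zero} p = refl
countFin≡sum {suc n} p with p Fin.zero
... | true = cong suc (countFin≡sum (p ∘ Fin.suc))
... | false = countFin≡sum (p ∘ Fin.suc)

∑-mono-≤ : ∀ {n} {f g : Fin n → ℕ} → (∀ i → f i ≤ g i) → sum f ≤ sum g
∑-mono-≤ {zero} f≤g = z≤n
∑-mono-≤ {suc n} f≤g = +-mono-≤ (f≤g Fin.zero) (∑-mono-≤ (f≤g ∘ Fin.suc))

∑∑-distrib-+ : ∀ {m n} (f g : Fin m → Fin n → ℕ) →
  ∑[ i < m ] ∑[ j < n ] (f i j + g i j) ≡ ∑[ i < m ] ∑[ j < n ] f i j + ∑[ i < m ] ∑[ j < n ] g i j
∑∑-distrib-+ {n = n} f g = trans (sum-cong-≗ (λ i → ∑-distrib-+ (f i) (g i)))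
  (∑-distrib-+ (λ i → ∑[ j < n ] f i j) (λ i → ∑[ j < n ] g i j))

*-distribˡ-∑∑ : ∀ {m n} c (f : Fin m → Fin n → ℕ) →
  c * ∑[ i < m ] ∑[ j < n ] f i j ≡ ∑[ i < m ] ∑[ j < n ] (c * f i j)
*-distribˡ-∑∑ {n = n} c f =
  trans (*-distribˡ-sum c (λ i → ∑[ j < n ] f i j)) (sum-cong-≗ (λ i → *-distribˡ-sum c (f i)))

∑-↑ : ∀ m {n} (f : Fin (m + n) → ℕ) → sum f ≡ ∑[ i < m ] f (i ↑ˡ n) + ∑[ j < n ] f (m ↑ʳ j)
∑-↑ zero f = refl
∑-↑ (suc m) {n} f = trans (cong (f Fin.zero +_) (∑-↑ m (f ∘ Fin.suc)))
  (sym (+-assoc (f Fin.zero) (∑[ i < m ] f (Fin.suc (i ↑ˡ n))) (∑[ j < n ] f (suc m ↑ʳ j))))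

entry≤∑ : ∀ {n} (f : Fin n → ℕ) i → f i ≤ sum f
entry≤∑ {suc n} f i = subst (f i ≤_) (sym (sum-remove {i = i} f)) (m≤m+n _ _)

∑-row+column≤∑∑ : ∀ {n} (h : Fin n → Fin n → ℕ) w → h w w ≡ 0 →
  ∑[ v < n ] h w v + ∑[ u < n ] h u w ≤ ∑[ u < n ] ∑[ v < n ] h u v
∑-row+column≤∑∑ {suc n} h w hww = begin
  row + ∑[ u < suc n ] h u w
    ≡⟨ cong (row +_) (sum-remove {i = w} (λ u → h u w)) ⟩
  row + (h w w + ∑[ u < n ] h (punchIn w u) w)
    ≡⟨ cong (λ c → row + (c + ∑[ u < n ] h (punchIn w u) w)) hww ⟩
  row + ∑[ u < n ] h (punchIn w u) w
    ≤⟨ +-monoʳ-≤ row (∑-mono-≤ (λ u → entry≤∑ (h (punchIn w u)) w)) ⟩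
  row + ∑[ u < n ] ∑[ v < suc n ] h (punchIn w u) v
    ≡⟨ sum-remove {i = w} (λ u → ∑[ v < suc n ] h u v) ⟨
  ∑[ u < suc n ] ∑[ v < suc n ] h u v ∎
  where
  open ≤-Reasoning
  row : ℕ
  row = ∑[ v < suc n ] h w v

Adjacency : ℕ → Set
Adjacency n = Fin n → Fin n → Bool

arcs : ∀ {n} → Adjacency n → ℕ
arcs {n} M = ∑[ x < n ] ∑[ y < n ] ⟦ M x y ⟧

arcs-cong : ∀ {n} {M N : Adjacency n} → (∀ x y → M x y ≡ N x y) → arcs M ≡ arcs N
arcs-cong M≡N = sum-cong-≗ (λ x → sum-cong-≗ (λ y → cong ⟦_⟧ (M≡N x y)))

⟦⟧-mono : ∀ {a b} → (a ≡ true → b ≡ true) → ⟦ a ⟧ ≤ ⟦ b ⟧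
⟦⟧-mono {false} a⇒b = z≤n
⟦⟧-mono {true} a⇒b rewrite a⇒b refl = ≤-refl

arcs-mono : ∀ {n} {M N : Adjacency n} → (∀ x y → M x y ≡ true → N x y ≡ true) → arcs M ≤ arcs N
arcs-mono M⊆N = ∑-mono-≤ (λ x → ∑-mono-≤ (λ y → ⟦⟧-mono (M⊆N x y)))

⟦⟧-∖ : ∀ {a b} → (a ≡ true → b ≡ true) → ⟦ b ⟧ ≡ ⟦ a ⟧ + ⟦ b ∧ not a ⟧
⟦⟧-∖ {false} {false} a⇒b = refl
⟦⟧-∖ {false} {true} a⇒b = refl
⟦⟧-∖ {true} a⇒b rewrite a⇒b refl = refl

arcs-∖ : ∀ {n} {M N : Adjacency n} → (∀ x y → M x y ≡ true → N x y ≡ true) →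
  arcs N ≡ arcs M + arcs (λ x y → N x y ∧ not (M x y))
arcs-∖ {M = M} {N} M⊆N = trans
  (sum-cong-≗ (λ x → sum-cong-≗ (λ y → ⟦⟧-∖ (M⊆N x y))))
  (∑∑-distrib-+ (λ x y → ⟦ M x y ⟧) (λ x y → ⟦ N x y ∧ not (M x y) ⟧))

adjacent⇒≢ : ∀ {n} (G : Graph n) {x y} → adj G x y ≡ true → x ≢ y
adjacent⇒≢ G {x} e refl with trans (sym e) (irrefl G x)
... | ()

<ᵇ-total : ∀ m n → m ≢ n → ⟦ m <ᵇ n ⟧ + ⟦ n <ᵇ m ⟧ ≡ 1
<ᵇ-total zero zero m≢n = ⊥-elim (m≢n refl)
<ᵇ-total zero (suc n) _ = refl
<ᵇ-total (suc m) zero _ = refl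
<ᵇ-total (suc m) (suc n) m≢n = <ᵇ-total m n (m≢n ∘ cong suc)

⟦adj⟧-orient : ∀ {n} (G : Graph n) x y →
  ⟦ adj G x y ⟧ ≡ ⟦ adj G x y ∧ (toℕ x <ᵇ toℕ y) ⟧ + ⟦ adj G y x ∧ (toℕ y <ᵇ toℕ x) ⟧
⟦adj⟧-orient G x y rewrite adj-sym G y x with adj G x y in e
... | false = refl
... | true = sym (<ᵇ-total (toℕ x) (toℕ y) (adjacent⇒≢ G e ∘ toℕ-injective))

edgeCount≡∑ : ∀ {n} (G : Graph n) →
  edgeCount G ≡ ∑[ x < n ] ∑[ y < n ] ⟦ adj G x y ∧ (toℕ x <ᵇ toℕ y) ⟧
edgeCount≡∑ {n} G =
  trans (sumFin≡sum (λ x → countFin (oriented x))) (sum-cong-≗ (countFin≡sum ∘ oriented))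
  where
  oriented : Adjacency n
  oriented x y = adj G x y ∧ (toℕ x <ᵇ toℕ y)

edgeCount-handshake : ∀ {n} (G : Graph n) → 2 * edgeCount G ≡ arcs (adj G)
edgeCount-handshake {n} G = begin
  2 * edgeCount G
    ≡⟨ cong (2 *_) (edgeCount≡∑ G) ⟩
  2 * E
    ≡⟨ cong (E +_) (+-identityʳ E) ⟩
  E + ∑[ y < n ] ∑[ x < n ] forward y x
    ≡⟨ cong (E +_) (∑-comm (λ y x → forward y x)) ⟩
  E + ∑[ x < n ] ∑[ y < n ] forward y x
    ≡⟨ ∑∑-distrib-+ forward (λ x y → forward y x) ⟨
  ∑[ x < n ] ∑[ y < n ] (forward x y + forward y x)
    ≡⟨ sum-cong-≗ (λ x → sum-cong-≗ (λ y → ⟦adj⟧-orient G x y)) ⟨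
  arcs (adj G) ∎
  where
  open ≡-Reasoning
  forward : Fin n → Fin n → ℕ
  forward x y = ⟦ adj G x y ∧ (toℕ x <ᵇ toℕ y) ⟧
  E : ℕ
  E = ∑[ x < n ] ∑[ y < n ] forward x y

edgeCount-∸ : ∀ {n} (G H : Graph n) → SpanningSub H G →
  2 * (edgeCount G ∸ edgeCount H) ≡ arcs (λ x y → adj G x y ∧ not (adj H x y))
edgeCount-∸ G H H⊆G = begin
  2 * (edgeCount G ∸ edgeCount H)
    ≡⟨ *-distribˡ-∸ 2 (edgeCount G) (edgeCount H) ⟩
  2 * edgeCount G ∸ 2 * edgeCount H
    ≡⟨ cong₂ _∸_ (edgeCount-handshake G) (edgeCount-handshake H) ⟩
  arcs (adj G) ∸ arcs (adj H)
    ≡⟨ cong (_∸ arcs (adj H)) (arcs-∖ H⊆G) ⟩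
  arcs (adj H) + arcs (λ x y → adj G x y ∧ not (adj H x y)) ∸ arcs (adj H)
    ≡⟨ m+n∸m≡n (arcs (adj H)) _ ⟩
  arcs (λ x y → adj G x y ∧ not (adj H x y)) ∎
  where open ≡-Reasoning

cut : ∀ {n} → Adjacency n → (Fin n → Bool) → ℕ
cut {n} M S = ∑[ x < n ] ∑[ y < n ] (⟦ S x ⟧ * ⟦ M x y ⟧ * ⟦ not (S y) ⟧)

⟦⟧-crossing : ∀ m a b →
  ⟦ m ∧ (a xor b) ⟧ ≡ ⟦ a ⟧ * ⟦ m ⟧ * ⟦ not b ⟧ + ⟦ b ⟧ * ⟦ m ⟧ * ⟦ not a ⟧
⟦⟧-crossing false false false = refl
⟦⟧-crossing false false true = refl
⟦⟧-crossing false true false = refl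
⟦⟧-crossing false true true = refl
⟦⟧-crossing true false false = refl
⟦⟧-crossing true false true = refl
⟦⟧-crossing true true false = refl
⟦⟧-crossing true true true = refl

arcs-crossing : ∀ {n} (G : Graph n) (S : Fin n → Bool) →
  arcs (λ x y → adj G x y ∧ (S x xor S y)) ≡ 2 * cut (adj G) S
arcs-crossing {n} G S = begin
  arcs (λ x y → adj G x y ∧ (S x xor S y))
    ≡⟨ sum-cong-≗ (λ x → sum-cong-≗ (λ y → crossing x y)) ⟩
  ∑[ x < n ] ∑[ y < n ] (outward x y + outward y x)
    ≡⟨ ∑∑-distrib-+ outward (λ x y → outward y x) ⟩
  cut (adj G) S + ∑[ x < n ] ∑[ y < n ] outward y x
    ≡⟨ cong (cut (adj G) S +_) (∑-comm (λ x y → outward y x)) ⟩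
  cut (adj G) S + cut (adj G) S
    ≡⟨ cong (cut (adj G) S +_) (+-identityʳ (cut (adj G) S)) ⟨
  2 * cut (adj G) S ∎
  where
  open ≡-Reasoning
  outward : Fin n → Fin n → ℕ
  outward x y = ⟦ S x ⟧ * ⟦ adj G x y ⟧ * ⟦ not (S y) ⟧
  crossing : ∀ x y → ⟦ adj G x y ∧ (S x xor S y) ⟧ ≡ outward x y + outward y x
  crossing x y rewrite adj-sym G y x = ⟦⟧-crossing (adj G x y) (S x) (S y)

ConstantOnEdges : ∀ {n} → Graph n → (Fin n → Bool) → Set
ConstantOnEdges H S = ∀ x y → adj H x y ≡ true → S x ≡ S y

constant-on-walks : ∀ {n} {H : Graph n} {S} → ConstantOnEdges H S →
  ∀ {x y} → Reach H x y → S x ≡ S y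
constant-on-walks const here = refl
constant-on-walks const (step e walk) = trans (const _ _ e) (constant-on-walks const walk)

constant⇒disconnected : ∀ {n} {H : Graph n} {S} → ConstantOnEdges H S →
  ∀ {x y} → S x ≡ true → S y ≡ false → ¬ Connected H
constant⇒disconnected const {x} {y} Sx Sy connected
  with trans (sym Sx) (trans (constant-on-walks const (connected x y)) Sy)
... | ()

crossing⊆missing : ∀ g h a b → (h ≡ true → a ≡ b) → g ∧ (a xor b) ≡ true → g ∧ not h ≡ true
crossing⊆missing true false a b h⇒a≡b e = refl
crossing⊆missing true true false true h⇒a≡b e = case h⇒a≡b refl of λ ()
crossing⊆missing true true true false h⇒a≡b e = case h⇒a≡b refl of λ ()

cut≤edgeCount-∸ : ∀ {n} (G H : Graph n) S → SpanningSub H G → ConstantOnEdges H S →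
  cut (adj G) S ≤ edgeCount G ∸ edgeCount H
cut≤edgeCount-∸ G H S H⊆G const = *-cancelˡ-≤ 2 (begin
  2 * cut (adj G) S
    ≡⟨ arcs-crossing G S ⟨
  arcs (λ x y → adj G x y ∧ (S x xor S y))
    ≤⟨ arcs-mono (λ x y → crossing⊆missing (adj G x y) (adj H x y) (S x) (S y) (const x y)) ⟩
  arcs (λ x y → adj G x y ∧ not (adj H x y))
    ≡⟨ edgeCount-∸ G H H⊆G ⟨
  2 * (edgeCount G ∸ edgeCount H) ∎)
  where open ≤-Reasoning

separate : ∀ {n} → Graph n → (Fin n → Bool) → Graph n
separate G S = record
  { adj    = λ x y → adj G x y ∧ not (S x xor S y)
  ; sym    = λ x y → cong₂ (λ g c → g ∧ not c) (adj-sym G x y) (xor-comm (S x) (S y))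
  ; irrefl = λ x → cong (_∧ not (S x xor S x)) (irrefl G x)
  }

separate-spanning : ∀ {n} (G : Graph n) S → SpanningSub (separate G S) G
separate-spanning G S x y e with adj G x y
... | true = refl

separate-constant : ∀ {n} (G : Graph n) S → ConstantOnEdges (separate G S) S
separate-constant G S x y e with adj G x y | S x | S y
... | true | false | false = refl
... | true | true | true = refl

∧-not-∧-not : ∀ g c → g ∧ not (g ∧ not c) ≡ g ∧ c
∧-not-∧-not false c = refl
∧-not-∧-not true false = refl
∧-not-∧-not true true = refl

edgeCount-∸-separate : ∀ {n} (G : Graph n) S →
  edgeCount G ∸ edgeCount (separate G S) ≡ cut (adj G) S
edgeCount-∸-separate G S = *-cancelˡ-≡ _ _ 2 (begin
  2 * (edgeCount G ∸ edgeCount (separate G S))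
    ≡⟨ edgeCount-∸ G (separate G S) (separate-spanning G S) ⟩
  arcs (λ x y → adj G x y ∧ not (adj G x y ∧ not (S x xor S y)))
    ≡⟨ arcs-cong (λ x y → ∧-not-∧-not (adj G x y) (S x xor S y)) ⟩
  arcs (λ x y → adj G x y ∧ (S x xor S y))
    ≡⟨ arcs-crossing G S ⟩
  2 * cut (adj G) S ∎)
  where open ≡-Reasoning

cut-singleton : ∀ {n} (G : Graph n) x → cut (adj G) (λ y → does (y ≟ x)) ≡ deg G x
cut-singleton {suc n} G x = begin
  cut (adj G) S
    ≡⟨ sum-remove {i = x} row ⟩
  row x + ∑[ z < n ] row (punchIn x z)
    ≡⟨ cong (row x +_) (sum-cong-≗ (λ z → row-outside (punchIn x z) (punchInᵢ≢i x z))) ⟩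
  row x + ∑[ z < n ] 0
    ≡⟨ cong (row x +_) (sum-replicate-zero n) ⟩
  row x + 0
    ≡⟨ +-identityʳ (row x) ⟩
  row x
    ≡⟨ sum-cong-≗ row-entry ⟩
  ∑[ y < suc n ] ⟦ adj G x y ⟧
    ≡⟨ countFin≡sum (adj G x) ⟨
  deg G x ∎
  where
  open ≡-Reasoning
  S : Fin (suc n) → Bool
  S y = does (y ≟ x)
  row : Fin (suc n) → ℕ
  row z = ∑[ y < suc n ] (⟦ S z ⟧ * ⟦ adj G z y ⟧ * ⟦ not (S y) ⟧)
  row-outside : ∀ z → z ≢ x → row z ≡ 0
  row-outside z z≢x rewrite dec-false (z ≟ x) z≢x = sum-replicate-zero (suc n)
  row-entry : ∀ y → ⟦ S x ⟧ * ⟦ adj G x y ⟧ * ⟦ not (S y) ⟧ ≡ ⟦ adj G x y ⟧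
  row-entry y rewrite dec-true (x ≟ x) refl with y ≟ x
  ... | yes refl rewrite irrefl G x = refl
  ... | no _ = trans (*-identityʳ _) (+-identityʳ _)

EdgeCut : ∀ {n} → Graph n → ℕ → Set
EdgeCut {n} G c =
  Σ (Graph n) λ H → SpanningSub H G × ¬ Connected H × (edgeCount G ∸ edgeCount H ≡ c)

EdgeConnectivity≥ : ∀ {n} → Graph n → ℕ → Set
EdgeConnectivity≥ G k = ∀ H → SpanningSub H G → ¬ Connected H → k ≤ edgeCount G ∸ edgeCount H

EdgeConnectivity≥⇒≤cut : ∀ {n} (G : Graph n) {k} → EdgeConnectivity≥ G k →
  ∀ S {x y} → S x ≡ true → S y ≡ false → k ≤ cut (adj G) S
EdgeConnectivity≥⇒≤cut G {k} bound S Sx Sy = subst (k ≤_) (edgeCount-∸-separate G S)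
  (bound (separate G S) (separate-spanning G S) (constant⇒disconnected (separate-constant G S) Sx Sy))

Separation : ∀ {n} → Graph n → Set
Separation {n} H = Σ (Fin n → Bool) λ S →
  ConstantOnEdges H S × ∃ (λ x → S x ≡ true) × ∃ (λ y → S y ≡ false)

¬¬-∀-Fin : ∀ {n} {P : Fin n → Set} → (∀ i → ¬ ¬ P i) → ¬ ¬ (∀ i → P i)
¬¬-∀-Fin {zero} ¬¬P ¬∀P = ¬∀P (λ ())
¬¬-∀-Fin {suc n} ¬¬P ¬∀P = ¬¬P Fin.zero λ P₀ → ¬¬-∀-Fin (¬¬P ∘ Fin.suc) λ P₊ →
  ¬∀P λ { Fin.zero → P₀ ; (Fin.suc i) → P₊ i }

Reach-snoc : ∀ {n} {H : Graph n} {x y z} → Reach H x y → adj H y z ≡ true → Reach H x z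
Reach-snoc here e = step e here
Reach-snoc (step e′ walk) e = step e′ (Reach-snoc walk e)

-- Reachability is decided only classically; this suffices because a separation is
-- only ever used to prove a decidable inequality.
disconnected⇒¬¬separation : ∀ {n} {H : Graph n} → ¬ Connected H → ¬ ¬ Separation H
disconnected⇒¬¬separation {n} {H} disconnected =
  ¬¬-map separation (¬¬-∀-Fin λ x → ¬¬-∀-Fin λ y → ¬¬-excluded-middle)
  where
  separation : (∀ x y → Dec (Reach H x y)) → Separation H
  separation reach? with ¬∀⟶∃¬ n _ (λ x → all? (reach? x)) disconnected
  ... | x , ¬reach-all with ¬∀⟶∃¬ n _ (reach? x) ¬reach-all
  ... | y , ¬reach =
    (λ z → does (reach? x z)) , constant ,
    (x , dec-true (reach? x x) here) , (y , dec-false (reach? x y) ¬reach)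
    where
    constant : ConstantOnEdges H (λ z → does (reach? x z))
    constant u v e with reach? x u | reach? x v
    ... | yes _ | yes _ = refl
    ... | no _ | no _ = refl
    ... | yes walk | no ¬walk = ⊥-elim (¬walk (Reach-snoc walk e))
    ... | no ¬walk | yes walk = ⊥-elim (¬walk (Reach-snoc walk (trans (adj-sym H v u) e)))

proj-↑ˡ : ∀ {n} (u : Fin n) → proj (u ↑ˡ n) ≡ u
proj-↑ˡ {n} u = cong [ id , id ]′ (splitAt-↑ˡ n u n)

proj-↑ʳ : ∀ {n} (u : Fin n) → proj (n ↑ʳ u) ≡ u
proj-↑ʳ {n} u = cong [ id , id ]′ (splitAt-↑ʳ n n u)

↑ˡ≢↑ʳ : ∀ {n} (u v : Fin n) → u ↑ˡ n ≢ n ↑ʳ v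
↑ˡ≢↑ʳ {n} u v eq with trans (sym (splitAt-↑ˡ n u n)) (trans (cong (splitAt n) eq) (splitAt-↑ʳ n n v))
... | ()

proj-fibre : ∀ {n} (x : Fin (n + n)) → x ≡ proj x ↑ˡ n ⊎ x ≡ n ↑ʳ proj x
proj-fibre {n} x with splitAt n x in eq
... | inj₁ u = inj₁ (sym (splitAt⁻¹-↑ˡ eq))
... | inj₂ u = inj₂ (sym (splitAt⁻¹-↑ʳ eq))

fibreSum : ∀ {n} → (Fin (n + n) → ℕ) → Fin n → ℕ
fibreSum {n} f u = f (u ↑ˡ n) + f (n ↑ʳ u)

∑-fibres : ∀ {n} (f : Fin (n + n) → ℕ) → sum f ≡ ∑[ u < n ] fibreSum f u
∑-fibres {n} f = trans (∑-↑ n f) (sym (∑-distrib-+ (λ u → f (u ↑ˡ n)) (λ u → f (n ↑ʳ u))))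

∑∑-fibres : ∀ {n} (F : Fin (n + n) → Fin (n + n) → ℕ) →
  ∑[ x < n + n ] ∑[ y < n + n ] F x y ≡ ∑[ u < n ] ∑[ v < n ] fibreSum (λ x → fibreSum (F x) v) u
∑∑-fibres {n} F = trans (∑-fibres {n} (λ x → ∑[ y < n + n ] F x y)) (sum-cong-≗ λ u →
  trans (cong₂ _+_ (∑-fibres {n} (F (u ↑ˡ n))) (∑-fibres {n} (F (n ↑ʳ u))))
        (sym (∑-distrib-+ (fibreSum {n} (F (u ↑ˡ n))) (fibreSum {n} (F (n ↑ʳ u))))))

inside outside : ∀ {n} → (Fin (n + n) → Bool) → Fin n → ℕ
inside S = fibreSum (⟦_⟧ ∘ S)
outside S = fibreSum (⟦_⟧ ∘ not ∘ S)

arcs-double : ∀ {n} (M : Adjacency n) → arcs (λ x y → M (proj x) (proj y)) ≡ 4 * arcs M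
arcs-double {n} M = begin
  arcs (λ x y → M (proj x) (proj y))
    ≡⟨ ∑∑-fibres {n} F ⟩
  ∑[ u < n ] ∑[ v < n ] fibreSum (λ x → fibreSum (F x) v) u
    ≡⟨ sum-cong-≗ (λ u → sum-cong-≗ (λ v → fibre-terms u v)) ⟩
  ∑[ u < n ] ∑[ v < n ] (4 * ⟦ M u v ⟧)
    ≡⟨ *-distribˡ-∑∑ 4 (λ u v → ⟦ M u v ⟧) ⟨
  4 * arcs M ∎
  where
  open ≡-Reasoning
  F : Fin (n + n) → Fin (n + n) → ℕ
  F x y = ⟦ M (proj x) (proj y) ⟧
  fibre-terms : ∀ u v → fibreSum (λ x → fibreSum (F x) v) u ≡ 4 * ⟦ M u v ⟧
  fibre-terms u v rewrite proj-↑ˡ u | proj-↑ʳ u | proj-↑ˡ v | proj-↑ʳ v =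
    solve 1 (λ m → (m :+ m) :+ (m :+ m) := con 4 :* m) refl ⟦ M u v ⟧

deg-double : ∀ {n} (G : Graph n) x → deg (double G) x ≡ 2 * deg G (proj x)
deg-double {n} G x = begin
  deg (double G) x
    ≡⟨ countFin≡sum (λ y → adj G (proj x) (proj y)) ⟩
  ∑[ y < n + n ] ⟦ adj G (proj x) (proj y) ⟧
    ≡⟨ ∑-fibres {n} (λ y → ⟦ adj G (proj x) (proj y) ⟧) ⟩
  ∑[ v < n ] (⟦ adj G (proj x) (proj (v ↑ˡ n)) ⟧ + ⟦ adj G (proj x) (proj (n ↑ʳ v)) ⟧)
    ≡⟨ sum-cong-≗ (λ v → cong₂ (λ a b → d a + d b) (proj-↑ˡ v) (proj-↑ʳ v)) ⟩
  ∑[ v < n ] (d v + d v)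
    ≡⟨ sum-cong-≗ (λ v → cong (d v +_) (+-identityʳ (d v))) ⟨
  ∑[ v < n ] (2 * d v)
    ≡⟨ *-distribˡ-sum 2 d ⟨
  2 * ∑[ v < n ] d v
    ≡⟨ cong (2 *_) (countFin≡sum (adj G (proj x))) ⟨
  2 * deg G (proj x) ∎
  where
  open ≡-Reasoning
  d : Fin n → ℕ
  d v = ⟦ adj G (proj x) v ⟧

double-spanning : ∀ {n} (G H : Graph n) → SpanningSub H G → SpanningSub (double H) (double G)
double-spanning G H H⊆G x y = H⊆G (proj x) (proj y)

Reach-proj : ∀ {n} {H : Graph n} {x y} → Reach (double H) x y → Reach H (proj x) (proj y)
Reach-proj here = here
Reach-proj (step e walk) = step e (Reach-proj walk)

double-disconnected : ∀ {n} {H : Graph n} → ¬ Connected H → ¬ Connected (double H)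
double-disconnected {n} {H} disconnected connected = disconnected λ u v →
  subst₂ (Reach H) (proj-↑ˡ u) (proj-↑ˡ v) (Reach-proj (connected (u ↑ˡ n) (v ↑ˡ n)))

edgeCount-∸-double : ∀ {n} (G H : Graph n) → SpanningSub H G →
  edgeCount (double G) ∸ edgeCount (double H) ≡ 4 * (edgeCount G ∸ edgeCount H)
edgeCount-∸-double {n} G H H⊆G = *-cancelˡ-≡ _ _ 2 (begin
  2 * (edgeCount (double G) ∸ edgeCount (double H))
    ≡⟨ edgeCount-∸ (double G) (double H) (double-spanning G H H⊆G) ⟩
  arcs (λ x y → missing (proj x) (proj y))
    ≡⟨ arcs-double missing ⟩
  4 * arcs missing
    ≡⟨ cong (4 *_) (edgeCount-∸ G H H⊆G) ⟨
  4 * (2 * d)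
    ≡⟨ trans (sym (*-assoc 4 2 d)) (*-assoc 2 4 d) ⟩
  2 * (4 * d) ∎)
  where
  open ≡-Reasoning
  missing : Adjacency n
  missing u v = adj G u v ∧ not (adj H u v)
  d : ℕ
  d = edgeCount G ∸ edgeCount H

double-EdgeCut : ∀ {n} (G : Graph n) {c} → EdgeCut G c → EdgeCut (double G) (4 * c)
double-EdgeCut G (H , H⊆G , disconnected , H-misses-c) =
  double H , double-spanning G H H⊆G , double-disconnected disconnected ,
  trans (edgeCount-∸-double G H H⊆G) (cong (4 *_) H-misses-c)

cut-double : ∀ {n} (G : Graph n) S →
  cut (adj (double G)) S ≡ ∑[ u < n ] ∑[ v < n ] (inside S u * ⟦ adj G u v ⟧ * outside S v)
cut-double {n} G S = trans (∑∑-fibres {n} T) (sum-cong-≗ λ u → sum-cong-≗ λ v → fibre-terms u v)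
  where
  T : Fin (n + n) → Fin (n + n) → ℕ
  T x y = ⟦ S x ⟧ * ⟦ adj G (proj x) (proj y) ⟧ * ⟦ not (S y) ⟧
  fibre-terms : ∀ u v → fibreSum (λ x → fibreSum (T x) v) u ≡ inside S u * ⟦ adj G u v ⟧ * outside S v
  fibre-terms u v rewrite proj-↑ˡ u | proj-↑ʳ u | proj-↑ˡ v | proj-↑ʳ v =
    solve 5 (λ a₁ a₂ g b₁ b₂ →
               (a₁ :* g :* b₁ :+ a₁ :* g :* b₂) :+ (a₂ :* g :* b₁ :+ a₂ :* g :* b₂)
               := (a₁ :+ a₂) :* g :* (b₁ :+ b₂)) refl
      ⟦ S (u ↑ˡ n) ⟧ ⟦ S (n ↑ʳ u) ⟧ ⟦ adj G u v ⟧
      ⟦ not (S (v ↑ˡ n)) ⟧ ⟦ not (S (n ↑ʳ v)) ⟧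

cut-double-lifted : ∀ {n} (G : Graph n) S → (∀ u → S (u ↑ˡ n) ≡ S (n ↑ʳ u)) →
  cut (adj (double G)) S ≡ 4 * cut (adj G) (λ u → S (u ↑ˡ n))
cut-double-lifted {n} G S lifted = begin
  cut (adj (double G)) S
    ≡⟨ cut-double G S ⟩
  ∑[ u < n ] ∑[ v < n ] (inside S u * ⟦ adj G u v ⟧ * outside S v)
    ≡⟨ sum-cong-≗ (λ u → sum-cong-≗ (λ v → lifted-terms u v)) ⟩
  ∑[ u < n ] ∑[ v < n ] (4 * lower u v)
    ≡⟨ *-distribˡ-∑∑ 4 lower ⟨
  4 * cut (adj G) (λ u → S (u ↑ˡ n)) ∎
  where
  open ≡-Reasoning
  lower : Fin n → Fin n → ℕ
  lower u v = ⟦ S (u ↑ˡ n) ⟧ * ⟦ adj G u v ⟧ * ⟦ not (S (v ↑ˡ n)) ⟧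
  lifted-terms : ∀ u v → inside S u * ⟦ adj G u v ⟧ * outside S v ≡ 4 * lower u v
  lifted-terms u v rewrite lifted u | lifted v =
    solve 3 (λ a g b → (a :+ a) :* g :* (b :+ b) := con 4 :* (a :* g :* b)) refl
      ⟦ S (n ↑ʳ u) ⟧ ⟦ adj G u v ⟧ ⟦ not (S (n ↑ʳ v)) ⟧

lifted-proj : ∀ {n} (S : Fin (n + n) → Bool) → (∀ u → S (u ↑ˡ n) ≡ S (n ↑ʳ u)) →
  ∀ x → S (proj x ↑ˡ n) ≡ S x
lifted-proj S lifted x with proj-fibre x
... | inj₁ x≡ = cong S (sym x≡)
... | inj₂ x≡ = trans (lifted (proj x)) (cong S (sym x≡))

⟦⟧-fibre : ∀ a b → (⟦ a ⟧ + ⟦ b ⟧) + (⟦ not a ⟧ + ⟦ not b ⟧) ≡ 2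
⟦⟧-fibre false false = refl
⟦⟧-fibre false true = refl
⟦⟧-fibre true false = refl
⟦⟧-fibre true true = refl

⟦⟧-split-fibre : ∀ {a b} → a ≢ b → (⟦ a ⟧ + ⟦ b ⟧ ≡ 1) × (⟦ not a ⟧ + ⟦ not b ⟧ ≡ 1)
⟦⟧-split-fibre {false} {false} a≢b = ⊥-elim (a≢b refl)
⟦⟧-split-fibre {false} {true} _ = refl , refl
⟦⟧-split-fibre {true} {false} _ = refl , refl
⟦⟧-split-fibre {true} {true} a≢b = ⊥-elim (a≢b refl)

cut-double-split : ∀ {n} (G : Graph n) S w → S (w ↑ˡ n) ≢ S (n ↑ʳ w) →
  2 * deg G w ≤ cut (adj (double G)) S
cut-double-split {n} G S w split = begin
  2 * deg G w
    ≡⟨ cong (2 *_) (countFin≡sum (adj G w)) ⟩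
  2 * ∑[ v < n ] ⟦ adj G w v ⟧
    ≡⟨ *-distribˡ-sum 2 (λ v → ⟦ adj G w v ⟧) ⟩
  ∑[ v < n ] (2 * ⟦ adj G w v ⟧)
    ≡⟨ sum-cong-≗ row+column ⟨
  ∑[ v < n ] (h w v + h v w)
    ≡⟨ ∑-distrib-+ (h w) (λ v → h v w) ⟩
  ∑[ v < n ] h w v + ∑[ u < n ] h u w
    ≤⟨ ∑-row+column≤∑∑ h w hww ⟩
  ∑[ u < n ] ∑[ v < n ] h u v
    ≡⟨ cut-double G S ⟨
  cut (adj (double G)) S ∎
  where
  open ≤-Reasoning
  h : Fin n → Fin n → ℕ
  h u v = inside S u * ⟦ adj G u v ⟧ * outside S v
  hww : h w w ≡ 0
  hww rewrite irrefl G w = cong (_* outside S w) (*-zeroʳ (inside S w))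
  row+column : ∀ v → h w v + h v w ≡ 2 * ⟦ adj G w v ⟧
  row+column v rewrite proj₁ (⟦⟧-split-fibre split) | proj₂ (⟦⟧-split-fibre split) | adj-sym G v w =
    trans (solve 3 (λ a b g → con 1 :* g :* b :+ a :* g :* con 1 := g :* (a :+ b)) refl
             (inside S v) (outside S v) ⟦ adj G w v ⟧)
          (trans (cong (⟦ adj G w v ⟧ *_) (⟦⟧-fibre (S (v ↑ˡ n)) (S (n ↑ʳ v))))
                 (*-comm ⟦ adj G w v ⟧ 2))

minFin≤ : ∀ {m} (f : Fin (suc m) → ℕ) i → minFin f ≤ f i
minFin≤ {zero} f Fin.zero = ≤-refl
minFin≤ {suc m} f Fin.zero = m⊓n≤m _ _
minFin≤ {suc m} f (Fin.suc i) = ≤-trans (m⊓n≤n (f Fin.zero) _) (minFin≤ (f ∘ Fin.suc) i)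

minFin-attained : ∀ {m} (f : Fin (suc m) → ℕ) → ∃ λ i → minFin f ≡ f i
minFin-attained {zero} f = Fin.zero , refl
minFin-attained {suc m} f with ⊓-sel (f Fin.zero) (minFin (f ∘ Fin.suc))
... | inj₁ min≡f₀ = Fin.zero , min≡f₀
... | inj₂ min≡rest with minFin-attained (f ∘ Fin.suc)
... | i , rest≡fᵢ = Fin.suc i , trans min≡rest rest≡fᵢ

δ-one-vertex : ∀ {m} (G : Graph (suc m)) → suc m ≤ 1 → δ G ≡ 0
δ-one-vertex {zero} G _ rewrite irrefl G Fin.zero = refl
δ-one-vertex {suc m} G (s≤s ())

cut-double-bound : ∀ {m} (G : Graph (suc m)) {k} → EdgeConnectivity≥ G k →
  ∀ S {x y} → S x ≡ true → S y ≡ false → (4 * k) ⊓ (2 * δ G) ≤ cut (adj (double G)) S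
cut-double-bound {m} G {k} bound S {x} {y} Sx Sy
  with all? (λ u → S (u ↑ˡ suc m) ≟ᵇ S (suc m ↑ʳ u))
... | yes lifted = ≤-trans (m⊓n≤m _ _) (begin
  4 * k
    ≤⟨ *-monoʳ-≤ 4 (EdgeConnectivity≥⇒≤cut G bound (λ u → S (u ↑ˡ suc m))
         (trans (lifted-proj S lifted x) Sx) (trans (lifted-proj S lifted y) Sy)) ⟩
  4 * cut (adj G) (λ u → S (u ↑ˡ suc m))
    ≡⟨ cut-double-lifted G S lifted ⟨
  cut (adj (double G)) S ∎)
  where open ≤-Reasoning
... | no ¬lifted with ¬∀⟶∃¬ (suc m) _ (λ u → S (u ↑ˡ suc m) ≟ᵇ S (suc m ↑ʳ u)) ¬lifted
... | w , split = ≤-trans (m⊓n≤n _ _)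
  (≤-trans (*-monoʳ-≤ 2 (minFin≤ (deg G) w)) (cut-double-split G S w split))

double-EdgeConnectivity≥ : ∀ {m} (G : Graph (suc m)) {k} → EdgeConnectivity≥ G k →
  EdgeConnectivity≥ (double G) ((4 * k) ⊓ (2 * δ G))
double-EdgeConnectivity≥ G {k} bound H H⊆D disconnected =
  decidable-stable ((4 * k) ⊓ (2 * δ G) ≤? _) (¬¬-map bound-by (disconnected⇒¬¬separation disconnected))
  where
  bound-by : Separation H → (4 * k) ⊓ (2 * δ G) ≤ edgeCount (double G) ∸ edgeCount H
  bound-by (S , constant , (x , Sx) , (y , Sy)) =
    ≤-trans (cut-double-bound G bound S Sx Sy) (cut≤edgeCount-∸ (double G) H S H⊆D constant)

double-EdgeCut-δ : ∀ {m} (G : Graph (suc m)) → EdgeCut (double G) (2 * δ G)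
double-EdgeCut-δ {m} G =
  separate (double G) S , separate-spanning (double G) S ,
  constant⇒disconnected (separate-constant (double G) S) {x = w ↑ˡ suc m} {y = suc m ↑ʳ w}
    (dec-true (w ↑ˡ suc m ≟ w ↑ˡ suc m) refl)
    (dec-false (suc m ↑ʳ w ≟ w ↑ˡ suc m) (↑ˡ≢↑ʳ w w ∘ sym)) ,
  (begin
    edgeCount (double G) ∸ edgeCount (separate (double G) S)
      ≡⟨ edgeCount-∸-separate (double G) S ⟩
    cut (adj (double G)) S
      ≡⟨ cut-singleton (double G) (w ↑ˡ suc m) ⟩
    deg (double G) (w ↑ˡ suc m)
      ≡⟨ deg-double G (w ↑ˡ suc m) ⟩
    2 * deg G (proj (w ↑ˡ suc m))
      ≡⟨ cong (λ v → 2 * deg G v) (proj-↑ˡ w) ⟩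
    2 * deg G w
      ≡⟨ cong (2 *_) δ≡deg-w ⟨
    2 * δ G ∎)
  where
  open ≡-Reasoning
  w : Fin (suc m)
  w = proj₁ (minFin-attained (deg G))
  δ≡deg-w : δ G ≡ deg G w
  δ≡deg-w = proj₂ (minFin-attained (deg G))
  S : Fin (suc m + suc m) → Bool
  S y = does (y ≟ w ↑ˡ suc m)

proposition3p3 : ∀ {m} (G : Graph (suc m)) → Connected G → (k : ℕ) → IsEdgeConnectivity G k
    → ((2 * k ≤ δ G → IsEdgeConnectivity (double G) (4 * k))
       × (δ G < 2 * k → k < δ G → IsEdgeConnectivity (double G) (2 * δ G)))
proposition3p3 {m} G _ k (cut-of-size-k , bound) = small , large
  where
  lower : EdgeConnectivity≥ (double G) ((4 * k) ⊓ (2 * δ G))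
  lower = double-EdgeConnectivity≥ G bound
  small : 2 * k ≤ δ G → IsEdgeConnectivity (double G) (4 * k)
  small 2k≤δ =
    inj₁ (doubled cut-of-size-k) , subst (EdgeConnectivity≥ (double G)) (m≤n⇒m⊓n≡m 4k≤2δ) lower
    where
    4k≤2δ : 4 * k ≤ 2 * δ G
    4k≤2δ = subst (_≤ 2 * δ G) (sym (*-assoc 2 2 k)) (*-monoʳ-≤ 2 2k≤δ)
    doubled : EdgeCut G k ⊎ (suc m ≤ 1 × k ≡ 0) → EdgeCut (double G) (4 * k)
    doubled (inj₁ cut-G) = double-EdgeCut G cut-G
    doubled (inj₂ (one-vertex , k≡0)) = subst (EdgeCut (double G))
      (trans (cong (2 *_) (δ-one-vertex G one-vertex)) (cong (4 *_) (sym k≡0))) (double-EdgeCut-δ G)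
  large : δ G < 2 * k → k < δ G → IsEdgeConnectivity (double G) (2 * δ G)
  large δ<2k _ =
    inj₁ (double-EdgeCut-δ G) , subst (EdgeConnectivity≥ (double G)) (m≥n⇒m⊓n≡n 2δ≤4k) lower
    where
    2δ≤4k : 2 * δ G ≤ 4 * k
    2δ≤4k = subst (2 * δ G ≤_) (sym (*-assoc 2 2 k)) (*-monoʳ-≤ 2 (<⇒≤ δ<2k))
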